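{- For every cut vertex $c_i$ of $G$, $W(c_i)=\bigcap_{b_j\in\mathrm{children}(c_i)} W(b_j)$, where the children are taken in the rooted block tree $BT(G)$.
   Context: Inversion: for a digraph $D$ and a tuple $\mathcal{Y}=(Y_1,\ldots,Y_k)$ of vertex subsets, $D\oplus\mathcal{Y}$ is obtained by successively reversing every arc with both endpoints in $Y_1$, then $Y_2$, etc.; $\mathcal{Y}$ is a decycling family (of size $k$) if $D\oplus\mathcal{Y}$ is acyclic. Convention: a decycling family of a subgraph $H$ of $D$ may consist of subsets of $V(D)$; vertices outside $H$ cause no arc changes in $H$. The weight of a vertex $v$ with respect to $\mathcal{Y}$ is the number of indices $j$ with $v\in Y_j$. Setting: $D$ is an oriented graph whose underlying undirected graph $G$ is a connected block graph (every 2-connected component, or block, is a clique), $k$ a fixed integer. Let $B_1,\ldots,B_p$ be the blocks and $c_1,\ldots,c_q$ the cut vertices of $G$. The block tree $BT(G)$ has a node $b_j$ for each block $B_j$ and a node $c_i$ for each cut vertex, with $c_ib_j$ an edge iff $c_i\in B_j$; it is rooted at $b_p$, with parent/children defined as usual. For a node $u$ of $BT(G)$, $D_u$ is the subdigraph of $D$ induced by the union of the vertex sets of the blocks $B_j$ whose nodes $b_j$ lie in the subtree rooted at $u$. For a cut vertex $c_i$, $W(c_i)$ is the set of $w\in\{0,\ldots,k\}$ such that $D_{c_i}$ has a decycling family of size $k$ in which $c_i$ has weight $w$. For a block node $b_i\ne b_p$ with parent $c_j$, $W(b_i)$ is the set of $w\in\{0,\ldots,k\}$ such that $D_{b_i}$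 has a decycling family of size $k$ in which $c_j$ has weight $w$. -}

module Defs where

open import Data.Nat using (ℕ; zero; suc; _+_; _≤_)
open import Data.Bool using (Bool; true; false; if_then_else_; _∧_; _∨_)
open import Data.Fin using (Fin)
open import Data.Fin.Subset using (Subset; _∈_; _⊆_; _-_; ⊤; Nonempty)
open import Data.Vec using (Vec; []; _∷_; lookup)
open import Data.Product using (Σ; _×_; ∃)
open import Data.Sum using (_⊎_; inj₁; inj₂)
open import Data.Empty using (⊥)
open import Data.Unit using () renaming (⊤ to Unit)
open import Relation.Nullary using (¬_)
open import Relation.Binary.PropositionalEquality using (_≡_; _≢_)
open import Relation.Binary.Construct.Closure.ReflexiveTransitive using (Star)
open import Relation.Binary.Construct.Closure.Transitive using (TransClosure)

Digraph : ℕ → Set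
Digraph n = Fin n → Fin n → Bool

Oriented : ∀ {n} → Digraph n → Set
Oriented A = (∀ x → A x x ≡ false) × (∀ x y → A x y ≡ true → A y x ≡ false)

-- Adjacency in the underlying undirected graph G.
Adj : ∀ {n} → Digraph n → Fin n → Fin n → Set
Adj A x y = (A x y ∨ A y x) ≡ true

VSet : ℕ → Set₁
VSet n = Fin n → Set

AdjIn : ∀ {n} → Digraph n → VSet n → Fin n → Fin n → Set
AdjIn A S x y = S x × S y × Adj A x y

ConnIn : ∀ {n} → Digraph n → VSet n → Set
ConnIn A S = ∀ x y → S x → S y → Star (AdjIn A S) x y

Connected : ∀ {n} → Digraph n → Set
Connected A = ConnIn A (λ _ → Unit)

Biconn : ∀ {n} → Digraph n → Subset n → Set
Biconn A B = Nonempty B × ConnIn A (_∈ B) × (∀ v → v ∈ B → ConnIn A (_∈ (B - v)))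

IsBlock : ∀ {n} → Digraph n → Subset n → Set
IsBlock A B = Biconn A B × (∀ B' → B ⊆ B' → Biconn A B' → B' ⊆ B)

BlockGraph : ∀ {n} → Digraph n → Set
BlockGraph A = ∀ B → IsBlock A B → ∀ x y → x ∈ B → y ∈ B → x ≢ y → Adj A x y

IsCut : ∀ {n} → Digraph n → Fin n → Set
IsCut A v = ¬ ConnIn A (_∈ (⊤ - v))

-- Block tree BT(G): nodes are blocks (inj₁) and cut vertices (inj₂).

BTNode : ℕ → Set
BTNode n = Subset n ⊎ Fin n

ValidNode : ∀ {n} → Digraph n → BTNode n → Set
ValidNode A (inj₁ B) = IsBlock A B
ValidNode A (inj₂ v) = IsCut A v

BTEdge : ∀ {n} → BTNode n → BTNode n → Set
BTEdge (inj₁ B) (inj₂ v) = v ∈ B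
BTEdge (inj₂ v) (inj₁ B) = v ∈ B
BTEdge (inj₁ _) (inj₁ _) = ⊥
BTEdge (inj₂ _) (inj₂ _) = ⊥

data ReachAvoid {n} (A : Digraph n) (R : Subset n) (u : BTNode n) : BTNode n → Set where
  start : inj₁ R ≢ u → ReachAvoid A R u (inj₁ R)
  step  : ∀ {y z} → ReachAvoid A R u y → ValidNode A z → BTEdge y z → z ≢ u →
          ReachAvoid A R u z

-- x lies in the subtree rooted at u (BT(G) rooted at R): every walk from the
-- root to x passes through u.
InSubtree : ∀ {n} → Digraph n → Subset n → BTNode n → BTNode n → Set
InSubtree A R u x = ¬ ReachAvoid A R u x

Child : ∀ {n} → Digraph n → Subset n → Fin n → Subset n → Set
Child A R c B = IsBlock A B × c ∈ B × InSubtree A R (inj₂ c) (inj₁ B)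

-- Vertex set of D_u: union of the blocks in the subtree rooted at u.
VD : ∀ {n} → Digraph n → Subset n → BTNode n → VSet n
VD {n} A R u x = Σ (Subset n) λ B → IsBlock A B × InSubtree A R u (inj₁ B) × x ∈ B

invert1 : ∀ {n} → Digraph n → Subset n → Digraph n
invert1 A Y x y = if lookup Y x ∧ lookup Y y then A y x else A x y

invert : ∀ {n k} → Digraph n → Vec (Subset n) k → Digraph n
invert A []       = A
invert A (Y ∷ Ys) = invert (invert1 A Y) Ys

ArcIn : ∀ {n} → Digraph n → VSet n → Fin n → Fin n → Set
ArcIn A S x y = S x × S y × A x y ≡ true

AcyclicIn : ∀ {n} → Digraph n → VSet n → Set
AcyclicIn A S = ∀ x → ¬ TransClosure (ArcIn A S) x x

weight : ∀ {n k} → Fin n → Vec (Subset n) k → ℕ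
weight v []       = 0
weight v (Y ∷ Ys) = (if lookup Y v then 1 else 0) + weight v Ys

-- w ∈ W(c): D_c has a decycling family of size k in which c has weight w.
WCut : ∀ {n} → Digraph n → ℕ → Subset n → Fin n → ℕ → Set
WCut {n} A k R c w = w ≤ k × Σ (Vec (Subset n) k) λ Y →
  AcyclicIn (invert A Y) (VD A R (inj₂ c)) × weight c Y ≡ w

-- w ∈ W(B) for a block B whose parent is the cut vertex c:
-- D_B has a decycling family of size k in which c has weight w.
WBlock : ∀ {n} → Digraph n → ℕ → Subset n → Fin n → Subset n → ℕ → Set
WBlock {n} A k R c B w = w ≤ k × Σ (Vec (Subset n) k) λ Y →
  AcyclicIn (invert A Y) (VD A R (inj₁ B)) × weight c Y ≡ w

{-# OPTIONS --safe #-}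

-- ⊆: a decycling family of D_c restricts to one of D_B for every child B of c, as D_B ⊆ D_c.
-- ⊇: every vertex x ≠ c of D_c lies in a component of G − c that does not meet the root block,
-- and such a component, together with c, lies in D_B for the child block B containing c and a
-- neighbour of c in that component. Inversions commute, so each child's family may be reordered
-- to put the sets containing c first; then all of them meet c in the same pattern, and they glue,
-- vertex by vertex, into a family for D_c in which c still has weight w. A directed cycle of the
-- glued digraph that avoids c stays in one component; one through c returns to c within a single
-- component. Either way it is a cycle of one child's decycled digraph. As c is a cut vertex it
-- has a child, which gives w ≤ k.
module Submission where

open import Defs
open import Level using (Level; _⊔_)
open import Data.Nat using (ℕ; zero; suc; _+_; _≤_; _<_; z≤n; s≤s)
open import Data.Nat.Properties
  using (≤-trans; ≤-reflexive; <-≤-trans; <-irrefl; <⇒≱; +-identityʳ; +-suc; +-monoˡ-≤; m≤n+m; n≤1+n)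
open import Data.Bool using (Bool; true; false; if_then_else_; _∧_; _∨_; _xor_)
open import Data.Bool.Properties
  using (∧-comm; ∨-comm; ∨-zeroʳ; xor-assoc; xor-comm) renaming (_≟_ to _≟ᵇ_)
open import Data.Empty using (⊥-elim)
open import Data.Unit using (tt) renaming (⊤ to Unit)
open import Data.Product using (Σ; ∃; _×_; _,_; proj₁; proj₂)
open import Data.Sum using (_⊎_; inj₁; inj₂) renaming (map to ⊎-map)
open import Data.Sum.Properties using (inj₂-injective)
open import Data.Maybe using (Maybe; just; nothing; fromMaybe)
import Data.Maybe as Maybe
open import Data.Fin using (Fin; zero; suc)
open import Data.Fin.Properties using (_≟_; any?; all?)
open import Data.Fin.Subset
  using (Subset; inside; outside; _∈_; _∉_; _⊆_; _∪_; _-_; ⁅_⁆; ∣_∣; ⊤) renaming (⊥ to ∅)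
open import Data.Fin.Subset.Properties
  using (_∈?_; _⊆?_; nonempty?; anySubset?; ∈⊤; x∈⁅x⁆; x∈⁅y⁆⇒x≡y; ∣⁅x⁆∣≡1; x∈p∪q⁺; x∈p∪q⁻;
         p⊆p∪q; q⊆p∪q; p─q⊆p; x∈p∧x≢y⇒x∈p-y; ⊆-reflexive; ⊆-trans; ⊆-antisym; p⊂q⇒∣p∣<∣q∣; ∣p∣≤n)
open import Data.Vec using (Vec; []; _∷_; _∷ʳ_; there; lookup; map; replicate; tabulate)
open import Data.Vec.Properties
  using (≡-dec; lookup⇒[]=; []=⇒lookup; lookup∘tabulate; lookup-map; map-∷ʳ)
open import Function using (_∘_; id)
open import Function.Bundles using (_⇔_; mk⇔)
open import Relation.Unary using (Pred; Decidable)
open import Relation.Nullary using (¬_; Dec; yes; no; does)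
open import Relation.Nullary.Decidable
  using (_×-dec_; _⊎-dec_; _→-dec_; ¬?; map′; dec-true; decidable-stable)
open import Relation.Binary using (Rel; DecidableEquality)
open import Relation.Binary.PropositionalEquality
  using (_≡_; _≢_; refl; sym; trans; cong; cong₂; subst; module ≡-Reasoning)
open import Relation.Binary.Construct.Closure.ReflexiveTransitive using (Star; ε; _◅_; _◅◅_)
import Relation.Binary.Construct.Closure.ReflexiveTransitive as Star
open import Relation.Binary.Construct.Closure.Transitive
  using (TransClosure; [_]; _∷_) renaming (_∷ʳ_ to _∷ʳ⁺_)

-- Finite choice and subsets of Fin n

first : ∀ {m ℓ} {P : Pred (Fin m) ℓ} → Decidable P → Maybe (Fin m)
first {zero}  P? = nothing
first {suc m} P? with P? zero
... | yes _ = just zero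
... | no  _ = Maybe.map suc (first (P? ∘ suc))

first-sound : ∀ {m ℓ} {P : Pred (Fin m) ℓ} (P? : Decidable P) {i} → first P? ≡ just i → P i
first-sound {suc m} P? eq with P? zero
first-sound {suc m} P? refl | yes p0 = p0
first-sound {suc m} P? eq   | no _ with first (P? ∘ suc) in found
first-sound {suc m} P? refl | no _ | just j = first-sound (P? ∘ suc) found

first-complete : ∀ {m ℓ} {P : Pred (Fin m) ℓ} (P? : Decidable P) {i} → P i →
                 ∃ λ j → first P? ≡ just j
first-complete {suc m} P? {i} pi with P? zero
... | yes _ = zero , refl
first-complete {suc m} P? {zero}  pi | no ¬p0 = ⊥-elim (¬p0 pi)
first-complete {suc m} P? {suc i} pi | no _ with first-complete (P? ∘ suc) pi
... | j , found rewrite found = suc j , refl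

first-cong : ∀ {m ℓ} {P Q : Pred (Fin m) ℓ} (P? : Decidable P) (Q? : Decidable Q) →
             (∀ i → P i → Q i) → (∀ i → Q i → P i) → first P? ≡ first Q?
first-cong {zero}  P? Q? P⇒Q Q⇒P = refl
first-cong {suc m} P? Q? P⇒Q Q⇒P with P? zero | Q? zero
... | yes _  | yes _  = refl
... | yes p0 | no ¬q0 = ⊥-elim (¬q0 (P⇒Q zero p0))
... | no ¬p0 | yes q0 = ⊥-elim (¬p0 (Q⇒P zero q0))
... | no _   | no _   rewrite first-cong (P? ∘ suc) (Q? ∘ suc) (P⇒Q ∘ suc) (Q⇒P ∘ suc) = refl

x∉p-x : ∀ {n} (x : Fin n) (p : Subset n) → x ∉ p - x
x∉p-x zero    (inside  ∷ p) ()
x∉p-x zero    (outside ∷ p) ()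
x∉p-x (suc x) (_ ∷ p) (there x∈p-x) = x∉p-x x p x∈p-x

module _ {n : ℕ} where

  x∈p-y⇒x∈p : ∀ {x y : Fin n} {p} → x ∈ p - y → x ∈ p
  x∈p-y⇒x∈p {y = y} {p} = p─q⊆p p ⁅ y ⁆

  x∈p-y⇒x≢y : ∀ {x y : Fin n} {p} → x ∈ p - y → x ≢ y
  x∈p-y⇒x≢y {p = p} x∈p-x refl = x∉p-x _ p x∈p-x

  _≟ₛ_ : DecidableEquality (Subset n)
  _≟ₛ_ = ≡-dec _≟ᵇ_

  select : ∀ {ℓ} {P : Pred (Fin n) ℓ} → Decidable P → Subset n
  select P? = tabulate (does ∘ P?)

  module _ {ℓ} {P : Pred (Fin n) ℓ} (P? : Decidable P) where

    ∈-select⁺ : ∀ {x} → P x → x ∈ select P?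
    ∈-select⁺ {x} px = lookup⇒[]= x _ (trans (lookup∘tabulate (does ∘ P?) x) (dec-true (P? x) px))

    ∈-select⁻ : ∀ {x} → x ∈ select P? → P x
    ∈-select⁻ {x} x∈ with P? x | trans (sym (lookup∘tabulate (does ∘ P?) x)) ([]=⇒lookup x∈)
    ... | yes px | _  = px
    ... | no  _  | ()

  p⊆q∧q≢p⇒∣p∣<∣q∣ : ∀ {p q : Subset n} → p ⊆ q → q ≢ p → ∣ p ∣ < ∣ q ∣
  p⊆q∧q≢p⇒∣p∣<∣q∣ {p} {q} p⊆q q≢p = p⊂q⇒∣p∣<∣q∣ (p⊆q , new)
    where
    new : ∃ λ y → y ∈ q × y ∉ p
    new with any? (λ y → (y ∈? q) ×-dec ¬? (y ∈? p))
    ... | yes found = found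
    ... | no none = ⊥-elim (q≢p (⊆-antisym q⊆p p⊆q))
      where
      q⊆p : q ⊆ p
      q⊆p {y} y∈q = decidable-stable (y ∈? p) (λ y∉p → none (y , y∈q , y∉p))

  module _ {ℓ} {P : Pred (Subset n) ℓ} (P? : Decidable P) where

    Maximal : Subset n → Set ℓ
    Maximal Y = P Y × (∀ Z → Y ⊆ Z → P Z → Z ⊆ Y)

    -- Every proper enlargement increases ∣ X ∣ ≤ n, so n of them suffice to reach a maximal set.
    ⊆-maximal : ∀ {X} → P X → ∃ λ Y → X ⊆ Y × Maximal Y
    ⊆-maximal {X} = extend n X (m≤n+m n ∣ X ∣)
      where
      spend : ∀ {fuel X Z} → n ≤ ∣ X ∣ + suc fuel → X ⊆ Z → Z ≢ X → n ≤ ∣ Z ∣ + fuel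
      spend {fuel} {X} {Z} bound X⊆Z Z≢X =
        ≤-trans bound (subst (_≤ ∣ Z ∣ + fuel) (sym (+-suc ∣ X ∣ fuel))
                             (+-monoˡ-≤ fuel (p⊆q∧q≢p⇒∣p∣<∣q∣ X⊆Z Z≢X)))

      extend : ∀ fuel X → n ≤ ∣ X ∣ + fuel → P X → ∃ λ Y → X ⊆ Y × Maximal Y
      extend fuel X bound pX with anySubset? (λ Z → P? Z ×-dec (X ⊆? Z) ×-dec ¬? (Z ≟ₛ X))
      ... | no none = X , id , pX , λ Z X⊆Z pZ →
        ⊆-reflexive (decidable-stable (Z ≟ₛ X) (λ Z≢X → none (Z , pZ , X⊆Z , Z≢X)))
      extend zero X bound pX | yes (Z , _ , X⊆Z , Z≢X) =
        ⊥-elim (<⇒≱ (p⊆q∧q≢p⇒∣p∣<∣q∣ X⊆Z Z≢X)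
                    (≤-trans (∣p∣≤n Z) (subst (n ≤_) (+-identityʳ _) bound)))
      extend (suc fuel) X bound pX | yes (Z , pZ , X⊆Z , Z≢X) with extend fuel Z (spend bound X⊆Z Z≢X) pZ
      ... | Y , Z⊆Y , maxY = Y , ⊆-trans X⊆Z Z⊆Y , maxY

-- Paths, biconnectivity and blocks

module Graph {n : ℕ} (A : Digraph n) where

  Path : VSet n → Fin n → Fin n → Set
  Path S = Star (AdjIn A S)

  Adj-sym : ∀ {x y} → Adj A x y → Adj A y x
  Adj-sym {x} {y} = trans (∨-comm (A y x) (A x y))

  Adj? : ∀ x y → Dec (Adj A x y)
  Adj? x y = (A x y ∨ A y x) ≟ᵇ true

  module _ {S : VSet n} where

    edge : ∀ {x y} → S x → S y → Adj A x y → Path S x y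
    edge sx sy xy = (sx , sy , xy) ◅ ε

    path-reverse : ∀ {x y} → Path S x y → Path S y x
    path-reverse = Star.reverse (λ (sx , sy , xy) → sy , sx , Adj-sym xy)

    path-source : ∀ {x y} → Path S x y → S y → S x
    path-source ε sy = sy
    path-source ((sx , _ , _) ◅ _) _ = sx

    path-target : ∀ {x y} → Path S x y → S x → S y
    path-target p = path-source (path-reverse p)

    hub-connected : ∀ h → (∀ {x} → S x → Path S x h) → ConnIn A S
    hub-connected h to-h x y sx sy = to-h sx ◅◅ path-reverse (to-h sy)

  path-mono : ∀ {S T : VSet n} → (∀ {w} → S w → T w) → ∀ {x y} → Path S x y → Path T x y
  path-mono S⊆T = Star.map (λ (sx , sy , xy) → S⊆T sx , S⊆T sy , xy)

  module _ {S : VSet n} where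

    vertices : ∀ {x y} → Path S x y → Subset n
    vertices {x} ε       = ⁅ x ⁆
    vertices {x} (_ ◅ p) = ⁅ x ⁆ ∪ vertices p

    ∈-vertices-◅⁻ : ∀ {x y z w} (e : AdjIn A S x y) (p : Path S y z) →
                    w ∈ vertices (e ◅ p) → w ≡ x ⊎ w ∈ vertices p
    ∈-vertices-◅⁻ {x} e p w∈ with x∈p∪q⁻ ⁅ x ⁆ (vertices p) w∈
    ... | inj₁ w∈⁅x⁆ = inj₁ (x∈⁅y⁆⇒x≡y x w∈⁅x⁆)
    ... | inj₂ w∈p   = inj₂ w∈p

    ∈-vertices-◅⁺ : ∀ {x y z w} (e : AdjIn A S x y) (p : Path S y z) →
                    w ∈ vertices p → w ∈ vertices (e ◅ p)
    ∈-vertices-◅⁺ {x} e p = q⊆p∪q ⁅ x ⁆ (vertices p)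

    source∈vertices : ∀ {x y} (p : Path S x y) → x ∈ vertices p
    source∈vertices ε       = x∈⁅x⁆ _
    source∈vertices (_ ◅ p) = x∈p∪q⁺ (inj₁ (x∈⁅x⁆ _))

    target∈vertices : ∀ {x y} (p : Path S x y) → y ∈ vertices p
    target∈vertices ε       = x∈⁅x⁆ _
    target∈vertices (e ◅ p) = ∈-vertices-◅⁺ e p (target∈vertices p)

    vertices⊆ : ∀ {x y w} (p : Path S x y) → S x → w ∈ vertices p → S w
    vertices⊆ ε sx w∈ with x∈⁅y⁆⇒x≡y _ w∈
    ... | refl = sx
    vertices⊆ (e@(_ , sy , _) ◅ p) sx w∈ with ∈-vertices-◅⁻ e p w∈
    ... | inj₁ refl = sx
    ... | inj₂ w∈p  = vertices⊆ p sy w∈p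

    prefix : ∀ {x y w} (p : Path S x y) → w ∈ vertices p → Path (_∈ vertices p) x w
    prefix ε w∈ with x∈⁅y⁆⇒x≡y _ w∈
    ... | refl = ε
    prefix (e@(_ , _ , xy) ◅ p) w∈ with ∈-vertices-◅⁻ e p w∈
    ... | inj₁ refl = ε
    ... | inj₂ w∈p  = (source∈vertices (e ◅ p) , ∈-vertices-◅⁺ e p (source∈vertices p) , xy)
                      ◅ path-mono (∈-vertices-◅⁺ e p) (prefix p w∈p)

    suffix : ∀ {x y w} (p : Path S x y) → w ∈ vertices p → Path (_∈ vertices p) w y
    suffix ε w∈ with x∈⁅y⁆⇒x≡y _ w∈
    ... | refl = ε
    suffix (e@(_ , _ , xy) ◅ p) w∈ with ∈-vertices-◅⁻ e p w∈
    ... | inj₁ refl = (source∈vertices (e ◅ p) , ∈-vertices-◅⁺ e p (source∈vertices p) , xy)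
                      ◅ path-mono (∈-vertices-◅⁺ e p) (suffix p (source∈vertices p))
    ... | inj₂ w∈p  = path-mono (∈-vertices-◅⁺ e p) (suffix p w∈p)

    Simple : ∀ {x y} → Path S x y → Set
    Simple ε           = Unit
    Simple {x} (_ ◅ p) = x ∉ vertices p × Simple p

    simple-suffix : ∀ {x y w} (p : Path S x y) → Simple p → w ∈ vertices p → Σ (Path S w y) Simple
    simple-suffix ε _ w∈ with x∈⁅y⁆⇒x≡y _ w∈
    ... | refl = ε , tt
    simple-suffix (e ◅ p) simple w∈ with ∈-vertices-◅⁻ e p w∈
    ... | inj₁ refl = e ◅ p , simple
    ... | inj₂ w∈p  = simple-suffix p (proj₂ simple) w∈p

    simplify : ∀ {x y} → Path S x y → Σ (Path S x y) Simple
    simplify ε = ε , tt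
    simplify {x} (e ◅ p) with simplify p
    ... | p′ , simple with x ∈? vertices p′
    ...   | yes x∈p′ = simple-suffix p′ simple x∈p′
    ...   | no  x∉p′ = e ◅ p′ , x∉p′ , simple

    split : ∀ {x y w z} (p : Path S x y) → Simple p → w ∈ vertices p → w ≢ z →
            Path (λ u → u ∈ vertices p × u ≢ z) x w ⊎ Path (λ u → u ∈ vertices p × u ≢ z) w y
    split ε _ w∈ _ with x∈⁅y⁆⇒x≡y _ w∈
    ... | refl = inj₁ ε
    split {x} {z = z} (e@(_ , _ , xy) ◅ p) (x∉p , simple) w∈ w≢z with ∈-vertices-◅⁻ e p w∈
    ... | inj₁ refl = inj₁ ε
    ... | inj₂ w∈p with x ≟ z
    ...   | yes refl = inj₂ (path-mono (λ u∈p → ∈-vertices-◅⁺ e p u∈p , λ { refl → x∉p u∈p })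
                                       (suffix p w∈p))
    ...   | no x≢z = ⊎-map (λ x′⋯w → ((source∈vertices (e ◅ p) , x≢z) ,
                                     widen (path-source x′⋯w (w∈p , w≢z)) , xy) ◅ path-mono widen x′⋯w)
                           (path-mono widen) (split p simple w∈p w≢z)
      where
      widen : ∀ {u} → u ∈ vertices p × u ≢ z → u ∈ vertices (e ◅ p) × u ≢ z
      widen (u∈p , u≢z) = ∈-vertices-◅⁺ e p u∈p , u≢z

  AdjIn? : ∀ (X : Subset n) x y → Dec (AdjIn A (_∈ X) x y)
  AdjIn? X x y = (x ∈? X) ×-dec (y ∈? X) ×-dec Adj? x y

  -- Breadth-first search: the i-th layer grows strictly until it is closed, so layer n is closed.
  module Reachability (X : Subset n) (x : Fin n) where

    Next : Subset n → Fin n → Set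
    Next F y = y ∈ F ⊎ ∃ λ z → z ∈ F × AdjIn A (_∈ X) z y

    next? : ∀ F y → Dec (Next F y)
    next? F y = y ∈? F ⊎-dec any? (λ z → (z ∈? F) ×-dec AdjIn? X z y)

    grow : Subset n → Subset n
    grow F = select (next? F)

    ⊆grow : ∀ F → F ⊆ grow F
    ⊆grow F y∈F = ∈-select⁺ (next? F) (inj₁ y∈F)

    layer : ℕ → Subset n
    layer zero    = ⁅ x ⁆
    layer (suc i) = grow (layer i)

    layer-sound : ∀ i {y} → y ∈ layer i → Path (_∈ X) x y
    layer-sound zero y∈ with x∈⁅y⁆⇒x≡y x y∈
    ... | refl = ε
    layer-sound (suc i) y∈ with ∈-select⁻ (next? (layer i)) y∈
    ... | inj₁ y∈F            = layer-sound i y∈F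
    ... | inj₂ (z , z∈F , zy) = layer-sound i z∈F ◅◅ zy ◅ ε

    x∈layer : ∀ i → x ∈ layer i
    x∈layer zero    = x∈⁅x⁆ x
    x∈layer (suc i) = ⊆grow (layer i) (x∈layer i)

    closed-complete : ∀ F → grow F ≡ F → ∀ {z y} → z ∈ F → Path (_∈ X) z y → y ∈ F
    closed-complete F closed z∈F ε          = z∈F
    closed-complete F closed z∈F (zw ◅ p) =
      closed-complete F closed (subst (_ ∈_) closed (∈-select⁺ (next? F) (inj₂ (_ , z∈F , zw)))) p

    closed-or-large : ∀ i → grow (layer i) ≡ layer i ⊎ suc i ≤ ∣ layer i ∣
    closed-or-large zero = inj₂ (≤-reflexive (sym (∣⁅x⁆∣≡1 x)))
    closed-or-large (suc i) with closed-or-large i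
    ... | inj₁ closed = inj₁ (cong grow closed)
    ... | inj₂ large with grow (layer i) ≟ₛ layer i
    ...   | yes closed = inj₁ (cong grow closed)
    ...   | no  grows  = inj₂ (<-≤-trans (s≤s large) (p⊆q∧q≢p⇒∣p∣<∣q∣ (⊆grow (layer i)) grows))

    layer-closed : grow (layer n) ≡ layer n
    layer-closed with closed-or-large n
    ... | inj₁ closed = closed
    ... | inj₂ large  = ⊥-elim (<-irrefl refl (≤-trans large (∣p∣≤n (layer n))))

    path? : ∀ y → Dec (Path (_∈ X) x y)
    path? y with y ∈? layer n
    ... | yes y∈ = yes (layer-sound n y∈)
    ... | no  y∉ = no λ p → y∉ (closed-complete (layer n) layer-closed (x∈layer n) p)

  path? : ∀ (X : Subset n) x y → Dec (Path (_∈ X) x y)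
  path? X x = Reachability.path? X x

  connected? : ∀ (X : Subset n) → Dec (ConnIn A (_∈ X))
  connected? X = all? λ x → all? λ y → (x ∈? X) →-dec (y ∈? X) →-dec path? X x y

  biconnected? : ∀ (X : Subset n) → Dec (Biconn A X)
  biconnected? X = nonempty? X ×-dec connected? X ×-dec all? λ v → (v ∈? X) →-dec connected? (X - v)

  block-⊇ : ∀ {X} → Biconn A X → ∃ λ B → X ⊆ B × IsBlock A B
  block-⊇ = ⊆-maximal biconnected?

  module _ {B : Subset n} (bB : Biconn A B) where

    biconn-path : ∀ {x y} → x ∈ B → y ∈ B → Path (_∈ B) x y
    biconn-path x∈B y∈B = proj₁ (proj₂ bB) _ _ x∈B y∈B

    biconn-path-avoiding : ∀ z {x y} → x ∈ B → y ∈ B → x ≢ z → y ≢ z →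
                           Path (λ w → w ∈ B × w ≢ z) x y
    biconn-path-avoiding z {x} {y} x∈B y∈B x≢z y≢z with z ∈? B
    ... | yes z∈B = path-mono (λ w∈B-z → x∈p-y⇒x∈p w∈B-z , x∈p-y⇒x≢y w∈B-z)
                      (proj₂ (proj₂ bB) z z∈B x y (x∈p∧x≢y⇒x∈p-y x∈B x≢z) (x∈p∧x≢y⇒x∈p-y y∈B y≢z))
    ... | no  z∉B = path-mono (λ w∈B → w∈B , λ { refl → z∉B w∈B }) (biconn-path x∈B y∈B)

  biconnected-edge : ∀ {v u} → Adj A v u → Biconn A (⁅ v ⁆ ∪ ⁅ u ⁆)
  biconnected-edge {v} {u} vu = (v , v∈) , two-vertices (λ w∈ → w∈) , λ z _ → two-vertices x∈p-y⇒x∈p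
    where
    v∈ : v ∈ ⁅ v ⁆ ∪ ⁅ u ⁆
    v∈ = x∈p∪q⁺ (inj₁ (x∈⁅x⁆ v))
    two-vertices : ∀ {S : VSet n} → (∀ {x} → S x → x ∈ ⁅ v ⁆ ∪ ⁅ u ⁆) → ConnIn A S
    two-vertices S⊆ x y sx sy with x∈p∪q⁻ ⁅ v ⁆ ⁅ u ⁆ (S⊆ sx) | x∈p∪q⁻ ⁅ v ⁆ ⁅ u ⁆ (S⊆ sy)
    ... | inj₁ x∈v | inj₁ y∈v rewrite x∈⁅y⁆⇒x≡y v x∈v | x∈⁅y⁆⇒x≡y v y∈v = ε
    ... | inj₂ x∈u | inj₂ y∈u rewrite x∈⁅y⁆⇒x≡y u x∈u | x∈⁅y⁆⇒x≡y u y∈u = ε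
    ... | inj₁ x∈v | inj₂ y∈u rewrite x∈⁅y⁆⇒x≡y v x∈v | x∈⁅y⁆⇒x≡y u y∈u = edge sx sy vu
    ... | inj₂ x∈u | inj₁ y∈v rewrite x∈⁅y⁆⇒x≡y u x∈u | x∈⁅y⁆⇒x≡y v y∈v = edge sx sy (Adj-sym vu)

  edge-block : ∀ {v u} → Adj A v u → ∃ λ B → IsBlock A B × v ∈ B × u ∈ B
  edge-block {v} {u} vu with block-⊇ (biconnected-edge vu)
  ... | B , ⊆B , bB = B , bB , ⊆B (x∈p∪q⁺ (inj₁ (x∈⁅x⁆ v))) , ⊆B (x∈p∪q⁺ (inj₂ (x∈⁅x⁆ u)))

  ∪-biconnected : ∀ {B₁ B₂ v b} → Biconn A B₁ → Biconn A B₂ → v ≢ b →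
                  v ∈ B₁ → v ∈ B₂ → b ∈ B₁ → b ∈ B₂ → Biconn A (B₁ ∪ B₂)
  ∪-biconnected {B₁} {B₂} {v} {b} bB₁ bB₂ v≢b v∈B₁ v∈B₂ b∈B₁ b∈B₂ =
    (v , x∈p∪q⁺ (inj₁ v∈B₁)) , hub-connected v to-v , minus
    where
    to-v : ∀ {x} → x ∈ B₁ ∪ B₂ → Path (_∈ B₁ ∪ B₂) x v
    to-v x∈ with x∈p∪q⁻ B₁ B₂ x∈
    ... | inj₁ x∈B₁ = path-mono (λ w∈ → x∈p∪q⁺ (inj₁ w∈)) (biconn-path bB₁ x∈B₁ v∈B₁)
    ... | inj₂ x∈B₂ = path-mono (λ w∈ → x∈p∪q⁺ (inj₂ w∈)) (biconn-path bB₂ x∈B₂ v∈B₂)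

    shared-avoiding : ∀ z → ∃ λ h → h ∈ B₁ × h ∈ B₂ × h ≢ z
    shared-avoiding z with v ≟ z
    ... | yes refl = b , b∈B₁ , b∈B₂ , λ b≡v → v≢b (sym b≡v)
    ... | no  v≢z  = v , v∈B₁ , v∈B₂ , v≢z

    minus : ∀ z → z ∈ B₁ ∪ B₂ → ConnIn A (_∈ (B₁ ∪ B₂) - z)
    minus z _ with shared-avoiding z
    ... | h , h∈B₁ , h∈B₂ , h≢z = hub-connected h to-h
      where
      to-h : ∀ {x} → x ∈ (B₁ ∪ B₂) - z → Path (_∈ (B₁ ∪ B₂) - z) x h
      to-h x∈ with x∈p∪q⁻ B₁ B₂ (x∈p-y⇒x∈p x∈)
      ... | inj₁ x∈B₁ = path-mono (λ (w∈ , w≢z) → x∈p∧x≢y⇒x∈p-y (x∈p∪q⁺ (inj₁ w∈)) w≢z)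
                          (biconn-path-avoiding bB₁ z x∈B₁ h∈B₁ (x∈p-y⇒x≢y x∈) h≢z)
      ... | inj₂ x∈B₂ = path-mono (λ (w∈ , w≢z) → x∈p∧x≢y⇒x∈p-y (x∈p∪q⁺ (inj₂ w∈)) w≢z)
                          (biconn-path-avoiding bB₂ z x∈B₂ h∈B₂ (x∈p-y⇒x≢y x∈) h≢z)

  ∪-ear-biconnected : ∀ {B v a y} → Biconn A B → v ∈ B → a ∈ B → a ≢ v →
                      (p : Path (_≢ v) a y) → Simple p → Adj A y v → Biconn A (B ∪ vertices p)
  ∪-ear-biconnected {B} {v} {a} {y} bB v∈B a∈B a≢v p simple yv =
    (a , inB a∈B) , hub-connected a to-a , minus
    where
    X : Subset n
    X = B ∪ vertices p
    inB : ∀ {w} → w ∈ B → w ∈ X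
    inB w∈ = x∈p∪q⁺ (inj₁ w∈)
    inP : ∀ {w} → w ∈ vertices p → w ∈ X
    inP w∈ = x∈p∪q⁺ (inj₂ w∈)
    inB-z : ∀ {z w} → w ∈ B × w ≢ z → w ∈ X - z
    inB-z (w∈ , w≢z) = x∈p∧x≢y⇒x∈p-y (inB w∈) w≢z
    inP-z : ∀ {z w} → w ∈ vertices p × w ≢ z → w ∈ X - z
    inP-z (w∈ , w≢z) = x∈p∧x≢y⇒x∈p-y (inP w∈) w≢z

    to-a : ∀ {x} → x ∈ X → Path (_∈ X) x a
    to-a x∈ with x∈p∪q⁻ B (vertices p) x∈
    ... | inj₁ x∈B = path-mono inB (biconn-path bB x∈B a∈B)
    ... | inj₂ x∈p = path-mono inP (path-reverse (prefix p x∈p))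

    minus : ∀ z → z ∈ X → ConnIn A (_∈ X - z)
    minus z _ with z ≟ v
    ... | yes refl = hub-connected a to-a-avoiding-v
      where
      to-a-avoiding-v : ∀ {x} → x ∈ X - z → Path (_∈ X - z) x a
      to-a-avoiding-v x∈ with x∈p∪q⁻ B (vertices p) (x∈p-y⇒x∈p x∈)
      ... | inj₁ x∈B = path-mono inB-z (biconn-path-avoiding bB z x∈B a∈B (x∈p-y⇒x≢y x∈) a≢v)
      ... | inj₂ x∈p = path-mono (λ w∈ → inP-z (w∈ , vertices⊆ p a≢v w∈)) (path-reverse (prefix p x∈p))
    ... | no z≢v = hub-connected v to-v
      where
      v≢z : v ≢ z
      v≢z v≡z = z≢v (sym v≡z)
      to-v : ∀ {x} → x ∈ X - z → Path (_∈ X - z) x v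
      to-v x∈ with x∈p∪q⁻ B (vertices p) (x∈p-y⇒x∈p x∈)
      ... | inj₁ x∈B = path-mono inB-z (biconn-path-avoiding bB z x∈B v∈B (x∈p-y⇒x≢y x∈) v≢z)
      ... | inj₂ x∈p with split p simple x∈p (x∈p-y⇒x≢y x∈)
      ...   | inj₁ a⋯x = path-mono inP-z (path-reverse a⋯x)
                         ◅◅ path-mono inB-z (biconn-path-avoiding bB z a∈B v∈B
                              (proj₂ (path-source a⋯x (x∈p , x∈p-y⇒x≢y x∈))) v≢z)
      ...   | inj₂ x⋯y = path-mono inP-z x⋯y
                         ◅◅ edge (inP-z (target∈vertices p ,
                                         proj₂ (path-target x⋯y (x∈p , x∈p-y⇒x≢y x∈))))
                                 (inB-z (v∈B , v≢z)) yv

  ear-in-block : ∀ {B v a y} → IsBlock A B → v ∈ B → a ∈ B → a ≢ v → Path (_≢ v) a y → Adj A y v → y ∈ B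
  ear-in-block (bB , maxB) v∈B a∈B a≢v a⋯y yv with simplify a⋯y
  ... | p , simple = maxB _ (p⊆p∪q (vertices p)) (∪-ear-biconnected bB v∈B a∈B a≢v p simple yv)
                       (x∈p∪q⁺ (inj₂ (target∈vertices p)))

  block-unique : BlockGraph A → ∀ {B₁ B₂ v a b} → IsBlock A B₁ → IsBlock A B₂ → v ∈ B₁ → v ∈ B₂ →
                 a ∈ B₁ → a ≢ v → b ∈ B₂ → b ≢ v → Path (_≢ v) a b → B₁ ≡ B₂
  block-unique clique {B₁} {B₂} {v} blB₁@(bB₁ , maxB₁) blB₂@(bB₂ , maxB₂)
               v∈B₁ v∈B₂ a∈B₁ a≢v b∈B₂ b≢v a⋯b =
    ⊆-antisym (λ w∈ → ∪⊆B₂ (x∈p∪q⁺ (inj₁ w∈))) (λ w∈ → ∪⊆B₁ (x∈p∪q⁺ (inj₂ w∈)))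
    where
    b∈B₁ : _ ∈ B₁
    b∈B₁ = ear-in-block blB₁ v∈B₁ a∈B₁ a≢v a⋯b (clique B₂ blB₂ _ v b∈B₂ v∈B₂ b≢v)
    bB₁∪B₂ : Biconn A (B₁ ∪ B₂)
    bB₁∪B₂ = ∪-biconnected bB₁ bB₂ (λ v≡b → b≢v (sym v≡b)) v∈B₁ v∈B₂ b∈B₁ b∈B₂
    ∪⊆B₁ : B₁ ∪ B₂ ⊆ B₁
    ∪⊆B₁ = maxB₁ _ (p⊆p∪q B₂) bB₁∪B₂
    ∪⊆B₂ : B₁ ∪ B₂ ⊆ B₂
    ∪⊆B₂ = maxB₂ _ (q⊆p∪q B₁ B₂) bB₁∪B₂

  block-⊈ : ∀ {B₁ B₂} → IsBlock A B₁ → IsBlock A B₂ → B₁ ≢ B₂ → ∃ λ a → a ∈ B₁ × a ∉ B₂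
  block-⊈ {B₁} {B₂} (bB₁ , maxB₁) (bB₂ , _) B₁≢B₂ with any? (λ a → (a ∈? B₁) ×-dec ¬? (a ∈? B₂))
  ... | yes found = found
  ... | no none = ⊥-elim (B₁≢B₂ (⊆-antisym B₁⊆B₂ (maxB₁ B₂ B₁⊆B₂ bB₂)))
    where
    B₁⊆B₂ : B₁ ⊆ B₂
    B₁⊆B₂ {a} a∈B₁ = decidable-stable (a ∈? B₂) (λ a∉B₂ → none (a , a∈B₁ , a∉B₂))

  shared-vertex-cut : BlockGraph A → ∀ {B₁ B₂ v} → IsBlock A B₁ → IsBlock A B₂ → B₁ ≢ B₂ →
                      v ∈ B₁ → v ∈ B₂ → IsCut A v
  shared-vertex-cut clique {B₁} {B₂} {v} blB₁ blB₂ B₁≢B₂ v∈B₁ v∈B₂ connected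
    with block-⊈ blB₁ blB₂ B₁≢B₂ | block-⊈ blB₂ blB₁ (λ eq → B₁≢B₂ (sym eq))
  ... | a , a∈B₁ , a∉B₂ | b , b∈B₂ , b∉B₁ =
    B₁≢B₂ (block-unique clique blB₁ blB₂ v∈B₁ v∈B₂ a∈B₁ a≢v b∈B₂ b≢v
             (path-mono x∈p-y⇒x≢y (connected a b (x∈p∧x≢y⇒x∈p-y ∈⊤ a≢v) (x∈p∧x≢y⇒x∈p-y ∈⊤ b≢v))))
    where
    a≢v : a ≢ v
    a≢v refl = a∉B₂ v∈B₂
    b≢v : b ≢ v
    b≢v refl = b∉B₁ v∈B₁

-- Inversions

prefixPattern : ∀ m → ℕ → Vec Bool m
prefixPattern zero    w       = []
prefixPattern (suc m) zero    = false ∷ prefixPattern m zero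
prefixPattern (suc m) (suc w) = true ∷ prefixPattern m w

prefixPattern-∷ʳ : ∀ m w → w ≤ m → prefixPattern m w ∷ʳ false ≡ prefixPattern (suc m) w
prefixPattern-∷ʳ zero    zero    _         = refl
prefixPattern-∷ʳ (suc m) zero    _         = cong (false ∷_) (prefixPattern-∷ʳ m zero z≤n)
prefixPattern-∷ʳ (suc m) (suc w) (s≤s w≤m) = cong (true ∷_) (prefixPattern-∷ʳ m w w≤m)

module _ {n : ℕ} where

  parity : ∀ {m} → Vec (Subset n) m → Fin n → Fin n → Bool
  parity []       x y = false
  parity (Y ∷ Ys) x y = (lookup Y x ∧ lookup Y y) xor parity Ys x y

  invert-parity : ∀ {m} (A : Digraph n) (Ys : Vec (Subset n) m) x y →
                  invert A Ys x y ≡ (if parity Ys x y then A y x else A x y)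
  invert-parity A []       x y = refl
  invert-parity A (Y ∷ Ys) x y
    rewrite invert-parity (invert1 A Y) Ys x y | ∧-comm (lookup Y y) (lookup Y x)
    = flip-twice (lookup Y x ∧ lookup Y y) (parity Ys x y)
    where
    flip-twice : ∀ s p → (if p then (if s then A x y else A y x) else (if s then A y x else A x y))
                         ≡ (if s xor p then A y x else A x y)
    flip-twice true  true  = refl
    flip-twice true  false = refl
    flip-twice false true  = refl
    flip-twice false false = refl

  AgreeAt : ∀ {m} → Fin n → Vec (Subset n) m → Vec (Subset n) m → Set
  AgreeAt x Ys Zs = ∀ j → lookup (lookup Ys j) x ≡ lookup (lookup Zs j) x

  parity-cong : ∀ {m} (Ys Zs : Vec (Subset n) m) {x y} → AgreeAt x Ys Zs → AgreeAt y Ys Zs →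
                parity Ys x y ≡ parity Zs x y
  parity-cong []       []       _  _  = refl
  parity-cong (Y ∷ Ys) (Z ∷ Zs) Yx Yy =
    cong₂ _xor_ (cong₂ _∧_ (Yx zero) (Yy zero))
                (parity-cong Ys Zs (λ j → Yx (suc j)) (λ j → Yy (suc j)))

  invert-parity-cong : ∀ {m m′} (A : Digraph n) (Ys : Vec (Subset n) m) (Zs : Vec (Subset n) m′) {x y} →
                       parity Ys x y ≡ parity Zs x y → invert A Ys x y ≡ invert A Zs x y
  invert-parity-cong A Ys Zs {x} {y} same-parity = begin
    invert A Ys x y                           ≡⟨ invert-parity A Ys x y ⟩
    (if parity Ys x y then A y x else A x y)  ≡⟨ cong (if_then A y x else A x y) same-parity ⟩
    (if parity Zs x y then A y x else A x y)  ≡⟨ invert-parity A Zs x y ⟨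
    invert A Zs x y                           ∎
    where open ≡-Reasoning

  invert-cong : ∀ {m} (A : Digraph n) (Ys Zs : Vec (Subset n) m) {x y} →
                AgreeAt x Ys Zs → AgreeAt y Ys Zs → invert A Ys x y ≡ invert A Zs x y
  invert-cong A Ys Zs Yx Yy = invert-parity-cong A Ys Zs (parity-cong Ys Zs Yx Yy)

  parity-∷ʳ : ∀ {m} (Ys : Vec (Subset n) m) Y x y →
              parity (Ys ∷ʳ Y) x y ≡ parity Ys x y xor (lookup Y x ∧ lookup Y y)
  parity-∷ʳ []       Y x y = xor-comm _ false
  parity-∷ʳ (Z ∷ Ys) Y x y =
    trans (cong ((lookup Z x ∧ lookup Z y) xor_) (parity-∷ʳ Ys Y x y))
          (sym (xor-assoc (lookup Z x ∧ lookup Z y) (parity Ys x y) _))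

  module _ (c : Fin n) where

    sortBy : ∀ {m} → Vec (Subset n) m → Vec (Subset n) m
    sortBy []       = []
    sortBy (Y ∷ Ys) with lookup Y c
    ... | true  = Y ∷ sortBy Ys
    ... | false = sortBy Ys ∷ʳ Y

    parity-sortBy : ∀ {m} (Ys : Vec (Subset n) m) x y → parity (sortBy Ys) x y ≡ parity Ys x y
    parity-sortBy []       x y = refl
    parity-sortBy (Y ∷ Ys) x y with lookup Y c
    ... | true  = cong ((lookup Y x ∧ lookup Y y) xor_) (parity-sortBy Ys x y)
    ... | false = begin
      parity (sortBy Ys ∷ʳ Y) x y                          ≡⟨ parity-∷ʳ (sortBy Ys) Y x y ⟩
      parity (sortBy Ys) x y xor (lookup Y x ∧ lookup Y y) ≡⟨ cong (_xor _) (parity-sortBy Ys x y) ⟩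
      parity Ys x y xor (lookup Y x ∧ lookup Y y)          ≡⟨ xor-comm (parity Ys x y) _ ⟩
      (lookup Y x ∧ lookup Y y) xor parity Ys x y          ∎
      where open ≡-Reasoning

    invert-sortBy : ∀ {m} (A : Digraph n) (Ys : Vec (Subset n) m) x y →
                    invert A (sortBy Ys) x y ≡ invert A Ys x y
    invert-sortBy A Ys x y = invert-parity-cong A (sortBy Ys) Ys (parity-sortBy Ys x y)

    weight≤length : ∀ {m} (Ys : Vec (Subset n) m) → weight c Ys ≤ m
    weight≤length []       = z≤n
    weight≤length (Y ∷ Ys) with lookup Y c
    ... | true  = s≤s (weight≤length Ys)
    ... | false = ≤-trans (weight≤length Ys) (n≤1+n _)

    sortBy-at : ∀ {m} (Ys : Vec (Subset n) m) j →
                lookup (lookup (sortBy Ys) j) c ≡ lookup (prefixPattern m (weight c Ys)) j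
    sortBy-at Ys j = trans (sym (lookup-map j (λ Y → lookup Y c) (sortBy Ys)))
                           (cong (λ bs → lookup bs j) (memberships-sortBy Ys))
      where
      memberships-sortBy : ∀ {m} (Ys : Vec (Subset n) m) →
                           map (λ Y → lookup Y c) (sortBy Ys) ≡ prefixPattern m (weight c Ys)
      memberships-sortBy []       = refl
      memberships-sortBy (Y ∷ Ys) with lookup Y c in Y∋c
      ... | true  = cong₂ _∷_ Y∋c (memberships-sortBy Ys)
      ... | false = begin
        map (λ Y → lookup Y c) (sortBy Ys ∷ʳ Y)          ≡⟨ map-∷ʳ (λ Y → lookup Y c) Y (sortBy Ys) ⟩
        map (λ Y → lookup Y c) (sortBy Ys) ∷ʳ lookup Y c ≡⟨ cong₂ _∷ʳ_ (memberships-sortBy Ys) Y∋c ⟩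
        prefixPattern _ (weight c Ys) ∷ʳ false           ≡⟨ prefixPattern-∷ʳ _ _ (weight≤length Ys) ⟩
        prefixPattern _ (weight c Ys)                    ∎
        where open ≡-Reasoning

    weight-prefixPattern : ∀ {m} (Ys : Vec (Subset n) m) w → w ≤ m →
                           (∀ j → lookup (lookup Ys j) c ≡ lookup (prefixPattern m w) j) → weight c Ys ≡ w
    weight-prefixPattern []       zero    _         _      = refl
    weight-prefixPattern (Y ∷ Ys) zero    _         at-c rewrite at-c zero =
      weight-prefixPattern Ys zero z≤n (λ j → at-c (suc j))
    weight-prefixPattern (Y ∷ Ys) (suc w) (s≤s w≤m) at-c rewrite at-c zero =
      cong suc (weight-prefixPattern Ys w w≤m (λ j → at-c (suc j)))

  invert⇒Adj : ∀ {m} (A : Digraph n) (Ys : Vec (Subset n) m) {x y} → invert A Ys x y ≡ true → Adj A x y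
  invert⇒Adj A Ys {x} {y} xy with parity Ys x y | invert-parity A Ys x y
  ... | true  | eq = subst (λ b → (A x y ∨ b) ≡ true) (trans (sym xy) eq) (∨-zeroʳ (A x y))
  ... | false | eq = subst (λ b → (b ∨ A y x) ≡ true) (trans (sym xy) eq) refl

-- Localising cycles and gluing families

module _ {a ℓ : Level} {X : Set a} {R : Rel X ℓ} where

  map⁺ : ∀ {ℓ′} {Q : Rel X ℓ′} → (∀ {x y} → R x y → Q x y) →
         ∀ {x y} → TransClosure R x y → TransClosure Q x y
  map⁺ R⇒Q [ xy ]      = [ R⇒Q xy ]
  map⁺ R⇒Q (xy ∷ rest) = R⇒Q xy ∷ map⁺ R⇒Q rest

  ⁺⇒* : ∀ {x y} → TransClosure R x y → Star R x y
  ⁺⇒* [ xy ]      = xy ◅ ε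
  ⁺⇒* (xy ∷ rest) = xy ◅ ⁺⇒* rest

  _◅◅⁺_ : ∀ {x y z} → Star R x y → TransClosure R y z → TransClosure R x z
  ε          ◅◅⁺ yz = yz
  (xw ◅ wy) ◅◅⁺ yz = xw ∷ (wy ◅◅⁺ yz)

-- As f is constant along arcs away from c, a closed walk avoiding c stays in one class of f,
-- and one through c returns to c inside a single class.
module Localisation {a ℓ : Level} {X : Set a} (_≟ₓ_ : DecidableEquality X) (_⇒_ : Rel X ℓ)
                    (c : X) {K : Set} (f : X → K)
                    (f-cong : ∀ {x y} → x ⇒ y → x ≢ c → y ≢ c → f x ≡ f y) (no-loop : ¬ c ⇒ c) where

  Near : K → X → Set a
  Near κ x = x ≡ c ⊎ f x ≡ κ

  Within : K → Rel X (a ⊔ ℓ)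
  Within κ x y = x ⇒ y × Near κ x × Near κ y

  class-step : ∀ {κ x y} → x ⇒ y → x ≢ c → y ≢ c → f x ≡ κ → f y ≡ κ
  class-step xy x≢c y≢c fx = trans (sym (f-cong xy x≢c y≢c)) fx

  walk : ∀ {κ x y} → TransClosure _⇒_ x y → x ≢ c → f x ≡ κ →
         (TransClosure (Within κ) x y × y ≢ c) ⊎ (TransClosure (Within κ) x c × Star _⇒_ c y)
  walk {y = y} [ xy ] x≢c fx with y ≟ₓ c
  ... | yes refl = inj₂ ([ xy , inj₂ fx , inj₁ refl ] , ε)
  ... | no  y≢c  = inj₁ ([ xy , inj₂ fx , inj₂ (class-step xy x≢c y≢c fx) ] , y≢c)
  walk (_∷_ {y = x′} xx′ rest) x≢c fx with x′ ≟ₓ c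
  ... | yes refl = inj₂ ([ xx′ , inj₂ fx , inj₁ refl ] , ⁺⇒* rest)
  ... | no  x′≢c with walk rest x′≢c (class-step xx′ x≢c x′≢c fx)
  ...   | inj₁ (p , y≢c) = inj₁ ((xx′ , inj₂ fx , inj₂ (class-step xx′ x≢c x′≢c fx)) ∷ p , y≢c)
  ...   | inj₂ (p , q)   = inj₂ ((xx′ , inj₂ fx , inj₂ (class-step xx′ x≢c x′≢c fx)) ∷ p , q)

  localise-at-c : TransClosure _⇒_ c c → ∃ λ z → z ≢ c × TransClosure (Within (f z)) z z
  localise-at-c [ cc ] = ⊥-elim (no-loop cc)
  localise-at-c (_∷_ {y = y} cy rest) with y ≟ₓ c
  ... | yes refl = ⊥-elim (no-loop cy)
  ... | no  y≢c with walk rest y≢c refl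
  ...   | inj₁ (_ , c≢c) = ⊥-elim (c≢c refl)
  ...   | inj₂ (p , _)   = y , y≢c , p ∷ʳ⁺ (cy , inj₁ refl , inj₂ refl)

  localise : ∀ {x} → TransClosure _⇒_ x x → ∃ λ z → z ≢ c × TransClosure (Within (f z)) z z
  localise {x} cycle with x ≟ₓ c
  ... | yes refl = localise-at-c cycle
  ... | no  x≢c with walk cycle x≢c refl
  ...   | inj₁ (p , _) = x , x≢c , p
  ...   | inj₂ (p , q) = localise-at-c (q ◅◅⁺ map⁺ proj₁ p)

module Gluing {n k : ℕ} (A : Digraph n) (c : Fin n) (S : VSet n)
              (Good : Fin n → Set) (rep : Fin n → Fin n)
              (T : Fin n → VSet n) (Fam : Fin n → Vec (Subset n) k) (at-c : Vec Bool k)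
              (no-loop : ¬ Adj A c c)
              (rep-cong : ∀ {x y} → x ≢ c → y ≢ c → Adj A x y → rep x ≡ rep y)
              (rep-good : ∀ {x} → S x → x ≢ c → Good (rep x) × T (rep x) x)
              (c∈T : ∀ {κ} → Good κ → T κ c)
              (Fam-at-c : ∀ {κ} → Good κ → ∀ j → lookup (lookup (Fam κ) j) c ≡ lookup at-c j)
              (Fam-acyclic : ∀ {κ} → Good κ → AcyclicIn (invert A (Fam κ)) (T κ)) where

  ∈glued : Fin k → Fin n → Bool
  ∈glued j x with x ≟ c
  ... | yes _ = lookup at-c j
  ... | no  _ = lookup (lookup (Fam (rep x)) j) x

  glued : Vec (Subset n) k
  glued = tabulate λ j → tabulate (∈glued j)

  glued-at : ∀ j x → lookup (lookup glued j) x ≡ ∈glued j x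
  glued-at j x = trans (cong (λ Y → lookup Y x) (lookup∘tabulate (λ j → tabulate (∈glued j)) j))
                       (lookup∘tabulate (∈glued j) x)

  glued-at-c : ∀ j → lookup (lookup glued j) c ≡ lookup at-c j
  glued-at-c j with c ≟ c | glued-at j c
  ... | yes _  | eq = eq
  ... | no c≢c | _  = ⊥-elim (c≢c refl)

  Arc : Rel (Fin n) _
  Arc = ArcIn (invert A glued) S

  open Localisation _≟_ Arc c rep
         (λ (_ , _ , xy) x≢c y≢c → rep-cong x≢c y≢c (invert⇒Adj A glued xy))
         (λ (_ , _ , cc) → no-loop (invert⇒Adj A glued cc))

  glued-agrees : ∀ {κ x} → Good κ → Near κ x → AgreeAt x glued (Fam κ)
  glued-agrees good (inj₁ refl) j = trans (glued-at-c j) (sym (Fam-at-c good j))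
  glued-agrees {x = x} good (inj₂ rep-x) j with x ≟ c | glued-at j x
  ... | yes refl | eq = trans eq (sym (Fam-at-c good j))
  ... | no _     | eq = trans eq (cong (λ κ → lookup (lookup (Fam κ) j) x) rep-x)

  near⇒T : ∀ {κ x} → Good κ → S x → Near κ x → T κ x
  near⇒T good _ (inj₁ refl) = c∈T good
  near⇒T {x = x} good sx (inj₂ rep-x) with x ≟ c
  ... | yes refl = c∈T good
  ... | no  x≢c  = subst (λ κ → T κ x) rep-x (proj₂ (rep-good sx x≢c))

  lift : ∀ {κ x y} → Good κ → Within κ x y → ArcIn (invert A (Fam κ)) (T κ) x y
  lift {κ} good ((sx , sy , xy) , near-x , near-y) =
    near⇒T good sx near-x , near⇒T good sy near-y ,
    trans (sym (invert-cong A glued (Fam κ) (glued-agrees good near-x) (glued-agrees good near-y))) xy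

  source∈S : ∀ {κ x y} → TransClosure (Within κ) x y → S x
  source∈S [ ((sx , _) , _) ]   = sx
  source∈S (((sx , _) , _) ∷ _) = sx

  glued-acyclic : AcyclicIn (invert A glued) S
  glued-acyclic x cycle with localise cycle
  ... | z , z≢c , cycle-z with rep-good (source∈S cycle-z) z≢c
  ...   | good , _ = Fam-acyclic good z (map⁺ (lift good) cycle-z)

-- The block tree at a cut vertex

module _ {n : ℕ} (A : Digraph n) (R : Subset n) {u : BTNode n} where

  ReachAvoid-≢ : ∀ {x} → ReachAvoid A R u x → x ≢ u
  ReachAvoid-≢ (start R≢u)        = R≢u
  ReachAvoid-≢ (step _ _ _ x≢u) = x≢u

  ReachAvoid-ind : ∀ (P : BTNode n → Set) → P (inj₁ R) →
                   (∀ {y z} → y ≢ u → P y → ValidNode A z → BTEdge y z → z ≢ u → P z) →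
                   ∀ {x} → ReachAvoid A R u x → P x
  ReachAvoid-ind P P-root P-step (start _)               = P-root
  ReachAvoid-ind P P-root P-step (step ra valid yz z≢u) =
    P-step (ReachAvoid-≢ ra) (ReachAvoid-ind P P-root P-step ra) valid yz z≢u

  ReachAvoid-retarget : ∀ {v} → ¬ ReachAvoid A R u v → ∀ {x} → ReachAvoid A R u x → ReachAvoid A R v x
  ReachAvoid-retarget v-hidden (start R≢u) = start λ { refl → v-hidden (start R≢u) }
  ReachAvoid-retarget v-hidden (step ra valid yz z≢u) =
    step (ReachAvoid-retarget v-hidden ra) valid yz λ { refl → v-hidden (step ra valid yz z≢u) }

AcyclicIn-subgraph : ∀ {n} {D D′ : Digraph n} {S S′ : VSet n} →
                     (∀ {x y} → ArcIn D′ S′ x y → ArcIn D S x y) → AcyclicIn D S → AcyclicIn D′ S′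
AcyclicIn-subgraph D′⊆D acyclic x cycle = acyclic x (map⁺ D′⊆D cycle)

subtree-child⊆ : ∀ {n} {A : Digraph n} {R c B} → Child A R c B →
                 ∀ {x} → VD A R (inj₁ B) x → VD A R (inj₂ c) x
subtree-child⊆ (_ , _ , B-below) (B′ , blB′ , B′-below , x∈B′) =
  B′ , blB′ , (λ ra → B′-below (ReachAvoid-retarget _ _ B-below ra)) , x∈B′

module AtCut {n : ℕ} (A : Digraph n) (loopless : ∀ x → A x x ≡ false) (clique : BlockGraph A)
             (R : Subset n) (blR : IsBlock A R) (c : Fin n) where
  open Graph A

  ¬Adj-refl : ∀ {x} → ¬ Adj A x x
  ¬Adj-refl {x} = subst (λ b → (b ∨ b) ≢ true) (sym (loopless x)) λ ()

  Adj⇒≢ : ∀ {x y} → Adj A x y → x ≢ y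
  Adj⇒≢ xy refl = ¬Adj-refl xy

  Linked : Fin n → Fin n → Set
  Linked = Path (_≢ c)

  linked? : ∀ x y → Dec (Linked x y)
  linked? x y = map′ (path-mono x∈p-y⇒x≢y) (path-mono (x∈p∧x≢y⇒x∈p-y ∈⊤)) (path? (⊤ - c) x y)

  RootSide : Fin n → Set
  RootSide x = ∃ λ r → r ∈ R × r ≢ c × Linked r x

  rootSide? : ∀ x → Dec (RootSide x)
  rootSide? x = any? λ r → (r ∈? R) ×-dec ¬? (r ≟ c) ×-dec linked? r x

  LowerNeighbour : Fin n → Set
  LowerNeighbour κ = Adj A c κ × ¬ RootSide κ

  lowerNeighbour? : ∀ κ → Dec (LowerNeighbour κ)
  lowerNeighbour? κ = Adj? c κ ×-dec ¬? (rootSide? κ)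

  BlocksOutside : Fin n → Set
  BlocksOutside v = ∀ B → IsBlock A B → v ∈ B → ReachAvoid A R (inj₂ c) (inj₁ B)

  enter-block : ∀ {v B₀} → IsBlock A B₀ → v ∈ B₀ → v ≢ c →
                ReachAvoid A R (inj₂ c) (inj₁ B₀) → BlocksOutside v
  enter-block {v} {B₀} blB₀ v∈B₀ v≢c B₀-out B blB v∈B with B ≟ₛ B₀
  ... | yes refl = B₀-out
  ... | no  B≢B₀ = step (step B₀-out v-cut v∈B₀ (v≢c ∘ inj₂-injective)) blB v∈B λ ()
    where
    v-cut : IsCut A v
    v-cut = shared-vertex-cut clique blB₀ blB (B≢B₀ ∘ sym) v∈B₀ v∈B

  linked-outside : ∀ {v x} → BlocksOutside v → Linked v x → BlocksOutside x
  linked-outside v-out ε = v-out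
  linked-outside v-out ((_ , w≢c , vw) ◅ w⋯x) with edge-block vw
  ... | B₀ , blB₀ , v∈B₀ , w∈B₀ = linked-outside (enter-block blB₀ w∈B₀ w≢c (v-out B₀ blB₀ v∈B₀)) w⋯x

  subtree∌rootSide : ∀ {x} → VD A R (inj₂ c) x → x ≢ c → ¬ RootSide x
  subtree∌rootSide (B , blB , B-below , x∈B) x≢c (r , r∈R , r≢c , r⋯x) =
    B-below (linked-outside (enter-block blR r∈R r≢c (start λ ())) r⋯x B blB x∈B)

  childBlock : Fin n → Subset n
  childBlock κ with Adj? c κ
  ... | yes cκ = proj₁ (edge-block cκ)
  ... | no  _  = R

  childBlock-spec : ∀ {κ} → Adj A c κ → IsBlock A (childBlock κ) × c ∈ childBlock κ × κ ∈ childBlock κ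
  childBlock-spec {κ} cκ with Adj? c κ
  ... | yes cκ′ = proj₂ (edge-block cκ′)
  ... | no ¬cκ  = ⊥-elim (¬cκ cκ)

  module _ {κ} (low : LowerNeighbour κ) where

    private
      blChild : IsBlock A (childBlock κ)
      blChild = proj₁ (childBlock-spec (proj₁ low))
      c∈child : c ∈ childBlock κ
      c∈child = proj₁ (proj₂ (childBlock-spec (proj₁ low)))
      κ∈child : κ ∈ childBlock κ
      κ∈child = proj₂ (proj₂ (childBlock-spec (proj₁ low)))

    Separated : BTNode n → Set
    Separated (inj₁ B) = ∀ x → x ∈ B → x ≢ c → ¬ Linked κ x
    Separated (inj₂ v) = v ≢ c → ¬ Linked κ v

    root-separated : Separated (inj₁ R)
    root-separated x x∈R x≢c κ⋯x = proj₂ low (x , x∈R , x≢c , path-reverse κ⋯x)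

    block-separated : ∀ {B v} → IsBlock A B → v ∈ B → v ≢ c → ¬ Linked κ v → Separated (inj₁ B)
    block-separated (bB , _) v∈B v≢c κ↛v x x∈B x≢c κ⋯x =
      κ↛v (κ⋯x ◅◅ path-mono proj₂ (biconn-path-avoiding bB c x∈B v∈B x≢c v≢c))

    outside-separated : ∀ {node} → ReachAvoid A R (inj₂ c) node → Separated node
    outside-separated = ReachAvoid-ind A R Separated root-separated separated-step
      where
      separated-step : ∀ {y z} → y ≢ inj₂ c → Separated y → ValidNode A z → BTEdge y z → z ≢ inj₂ c →
                       Separated z
      separated-step {inj₁ B} {inj₂ v} _   sep _   v∈B _ = sep v v∈B
      separated-step {inj₂ v} {inj₁ B} v≢c sep blB v∈B _ =
        block-separated blB v∈B (v≢c ∘ cong inj₂) (sep (v≢c ∘ cong inj₂))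

    -- The only block through c that meets κ's component of G − c is the child block itself.
    off-child-separated : ∀ {node} → ReachAvoid A R (inj₁ (childBlock κ)) node → Separated node
    off-child-separated = ReachAvoid-ind A R Separated root-separated separated-step
      where
      separated-step : ∀ {y z} → y ≢ inj₁ (childBlock κ) → Separated y → ValidNode A z → BTEdge y z →
                       z ≢ inj₁ (childBlock κ) → Separated z
      separated-step {inj₁ B} {inj₂ v} _ sep _   v∈B _ = sep v v∈B
      separated-step {inj₂ v} {inj₁ B} _ sep blB v∈B B≢child with v ≟ c
      ... | no  v≢c  = block-separated blB v∈B v≢c (sep v≢c)
      ... | yes refl = λ x x∈B x≢c κ⋯x →
        B≢child (cong inj₁ (sym (block-unique clique blChild blB c∈child v∈B κ∈child
                                   (path-source κ⋯x x≢c) x∈B x≢c κ⋯x)))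

    childBlock-child : Child A R c (childBlock κ)
    childBlock-child = blChild , c∈child ,
      λ ra → outside-separated ra κ κ∈child (Adj⇒≢ (proj₁ low) ∘ sym) ε

    linked⇒subtree : ∀ {B x} → IsBlock A B → x ∈ B → x ≢ c → Linked κ x → VD A R (inj₁ (childBlock κ)) x
    linked⇒subtree {B} {x} blB x∈B x≢c κ⋯x = B , blB , (λ ra → off-child-separated ra x x∈B x≢c κ⋯x) , x∈B

    c∈subtree : VD A R (inj₁ (childBlock κ)) c
    c∈subtree = childBlock κ , blChild , (λ ra → ReachAvoid-≢ A R ra refl) , c∈child

  Attached : Fin n → Fin n → Set
  Attached x u = Adj A c u × Linked x u

  attached? : ∀ x u → Dec (Attached x u)
  attached? x u = Adj? c u ×-dec linked? x u

  -- The first neighbour of c in x's component of G − c; the default c is never used.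
  rep : Fin n → Fin n
  rep x = fromMaybe c (first (attached? x))

  rep-attached : ∀ {x} → ∃ (Attached x) → Attached x (rep x)
  rep-attached {x} (u , x-u) with first-complete (attached? x) x-u
  ... | _ , found rewrite found = first-sound (attached? x) found

  rep-cong : ∀ {x y} → Linked x y → rep x ≡ rep y
  rep-cong x⋯y = cong (fromMaybe c) (first-cong (attached? _) (attached? _)
    (λ _ (cu , x⋯u) → cu , path-reverse x⋯y ◅◅ x⋯u)
    (λ _ (cu , y⋯u) → cu , x⋯y ◅◅ y⋯u))

  attached-exists : Connected A → ∀ {x} → x ≢ c → ∃ (Attached x)
  attached-exists connected x≢c = along x≢c (connected _ c tt tt)
    where
    along : ∀ {y} → y ≢ c → Star (AdjIn A (λ _ → Unit)) y c → ∃ (Attached y)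
    along y≢c ε = ⊥-elim (y≢c refl)
    along {y} y≢c (_◅_ {j = y′} (_ , _ , yy′) y′⋯c) with y′ ≟ c
    ... | yes refl = y , Adj-sym yy′ , ε
    ... | no  y′≢c with along y′≢c y′⋯c
    ...   | u , cu , y′⋯u = u , cu , (y≢c , y′≢c , yy′) ◅ y′⋯u

  rep-lower : Connected A → ∀ {x} → VD A R (inj₂ c) x → x ≢ c → LowerNeighbour (rep x) × Linked (rep x) x
  rep-lower connected x∈ x≢c with rep-attached (attached-exists connected x≢c)
  ... | c-rep , x⋯rep = (c-rep , λ (r , r∈R , r≢c , r⋯rep) →
                           subtree∌rootSide x∈ x≢c (r , r∈R , r≢c , r⋯rep ◅◅ path-reverse x⋯rep)) ,
                        path-reverse x⋯rep

  lowerNeighbour-exists : Connected A → IsCut A c → ∃ LowerNeighbour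
  lowerNeighbour-exists connected c-cut with any? lowerNeighbour?
  ... | yes found = found
  ... | no  none  = ⊥-elim (c-cut λ x y x∈ y∈ →
          path-mono (x∈p∧x≢y⇒x∈p-y ∈⊤) (via-R (rootSide (x∈p-y⇒x≢y x∈)) (rootSide (x∈p-y⇒x≢y y∈))))
    where
    rootSide : ∀ {x} → x ≢ c → RootSide x
    rootSide x≢c with attached-exists connected x≢c
    ... | u , cu , x⋯u with rootSide? u
    ...   | yes (r , r∈R , r≢c , r⋯u) = r , r∈R , r≢c , r⋯u ◅◅ path-reverse x⋯u
    ...   | no  ¬root                 = ⊥-elim (none (u , cu , ¬root))
    via-R : ∀ {x y} → RootSide x → RootSide y → Linked x y
    via-R (r , r∈R , r≢c , r⋯x) (s , s∈R , s≢c , s⋯y) =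
      path-reverse r⋯x ◅◅ path-mono proj₂ (biconn-path-avoiding (proj₁ blR) c r∈R s∈R r≢c s≢c) ◅◅ s⋯y

module GluingAtCut {n} (A : Digraph n) (k : ℕ) (R : Subset n) (oriented : Oriented A)
                   (connected : Connected A) (clique : BlockGraph A) (blR : IsBlock A R)
                   (c : Fin n) (c-cut : IsCut A c) (w : ℕ)
                   (weights : ∀ B → Child A R c B → WBlock A k R c B w) where
  open Graph A using (edge)
  open AtCut A (proj₁ oriented) clique R blR c

  -- Only ever consulted at lower neighbours; the empty family elsewhere is a placeholder.
  childFamily : Fin n → Vec (Subset n) k
  childFamily κ with lowerNeighbour? κ
  ... | yes low = sortBy c (proj₁ (proj₂ (weights (childBlock κ) (childBlock-child low))))
  ... | no  _   = replicate k ∅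

  childFamily-at-c : ∀ {κ} → LowerNeighbour κ →
                     ∀ j → lookup (lookup (childFamily κ) j) c ≡ lookup (prefixPattern k w) j
  childFamily-at-c {κ} low j with lowerNeighbour? κ
  ... | no ¬low = ⊥-elim (¬low low)
  ... | yes low′ with weights (childBlock κ) (childBlock-child low′)
  ...   | _ , Zs , _ , weight≡w =
    trans (sortBy-at c Zs j) (cong (λ v → lookup (prefixPattern k v) j) weight≡w)

  childFamily-acyclic : ∀ {κ} → LowerNeighbour κ →
                        AcyclicIn (invert A (childFamily κ)) (VD A R (inj₁ (childBlock κ)))
  childFamily-acyclic {κ} low with lowerNeighbour? κ
  ... | no ¬low = ⊥-elim (¬low low)
  ... | yes low′ with weights (childBlock κ) (childBlock-child low′)
  ...   | _ , Zs , acyclic , _ =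
    AcyclicIn-subgraph (λ {x} {y} (sx , sy , xy) → sx , sy , trans (sym (invert-sortBy c A Zs x y)) xy)
                       acyclic

  rep-good : ∀ {x} → VD A R (inj₂ c) x → x ≢ c →
             LowerNeighbour (rep x) × VD A R (inj₁ (childBlock (rep x))) x
  rep-good x∈@(_ , blB , _ , x∈B) x≢c with rep-lower connected x∈ x≢c
  ... | low , rep⋯x = low , linked⇒subtree low blB x∈B x≢c rep⋯x

  open Gluing A c (VD A R (inj₂ c)) LowerNeighbour rep (λ κ → VD A R (inj₁ (childBlock κ)))
              childFamily (prefixPattern k w) ¬Adj-refl
              (λ x≢c y≢c xy → rep-cong (edge x≢c y≢c xy)) rep-good c∈subtree
              childFamily-at-c childFamily-acyclic

  glued-weights : WCut A k R c w
  glued-weights = w≤k , glued , glued-acyclic , weight-prefixPattern c glued w w≤k glued-at-c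
    where
    w≤k : w ≤ k
    w≤k = proj₁ (weights _ (childBlock-child (proj₂ (lowerNeighbour-exists connected c-cut))))

restrict-to-child : ∀ {n} {A : Digraph n} {k R c w} →
                    WCut A k R c w → ∀ B → Child A R c B → WBlock A k R c B w
restrict-to-child (w≤k , Y , acyclic , weight≡w) B child =
  w≤k , Y ,
  AcyclicIn-subgraph (λ (sx , sy , xy) → subtree-child⊆ child sx , subtree-child⊆ child sy , xy) acyclic ,
  weight≡w

lemma7 : ∀ {n} (A : Digraph n) (k : ℕ) (R : Subset n) →
         Oriented A → Connected A → BlockGraph A → IsBlock A R →
         ∀ (c : Fin n) → IsCut A c → ∀ (w : ℕ) →
         WCut A k R c w ⇔ (∀ (B : Subset n) → Child A R c B → WBlock A k R c B w)
lemma7 A k R oriented connected clique blR c c-cut w =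
  mk⇔ restrict-to-child (GluingAtCut.glued-weights A k R oriented connected clique blR c c-cut w)
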